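{- Let $k\ge 4$, let $p$ be an odd prime, and let $\mathbf a=(a_1,p^{e_2}a_2,p^{e_3}a_3,\dots,p^{e_k}a_k)$ where $0\le e_2\le e_3\le\cdots\le e_k$ are integers, $a_1,\dots,a_k$ are positive integers coprime to $p$, and $\gcd(a_1,p^{e_2}a_2,\dots,p^{e_k}a_k)=1$. Assume $\overline{DQ_p(\mathbf a)}\ne\mathbb Z_p$. Let $\beta$ be the sum of those coordinates of $\mathbf a$ that are coprime to $p$. Then for every nonnegative integer $n$: (i) if $\mathcal T(\mathbf a)$ is regular and $n$ is locally represented by $\mathcal T(\Lambda_p(\mathbf a))$, then $n$ is represented by $\mathcal T(\Lambda_p(\mathbf a))$; (ii) if $\mathcal T(\Lambda_p(\mathbf a))$ is regular, $n$ is locally represented by $\mathcal T(\mathbf a)$, $t(n,\mathbf a)\equiv 0\pmod p$, and $n\ge\frac{p^2-1}{8}\beta$, then $n$ is represented by $\mathcal T(\mathbf a)$.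
   Context: For positive integers $c_1,\dots,c_k$, $\mathcal T(c_1,\dots,c_k)$ denotes the triangular form $c_1\frac{x_1(x_1+1)}{2}+\cdots+c_k\frac{x_k(x_k+1)}{2}$; $n\ge 0$ is represented by it if it equals the form at a point of $\mathbb Z^k$, locally represented if the equation has a solution in $\mathbb Z_q^k$ for every prime $q$; the form is regular if it represents every positive integer it locally represents. For $\mathbf c=(c_1,\dots,c_k)$, $t(n,\mathbf c)=8n+c_1+\cdots+c_k$ and $\overline{DQ_p(\mathbf c)}=\{\gamma\in\mathbb Z_p:\gamma=c_1y_1^2+\cdots+c_ky_k^2,\ y_i\in\mathbb Z_p\}$. For a vector $\mathbf c=(c_1,\dots,c_k)$ of positive integers with gcd 1 and an odd prime $p$, put $s_i=0$ if $p\mid c_i$ and $s_i=2$ otherwise; then $\Lambda_p(\mathbf c)=(p^{s_1}c_1,\dots,p^{s_k}c_k)$. -}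

module Defs where

open import Data.Nat using (ℕ; zero; suc; _+_; _*_; _^_; _≤_)
open import Data.Nat.Divisibility using (_∣?_)
open import Data.Nat.Coprimality using (coprime?)
open import Data.Nat.GCD using (gcd)
open import Data.Integer as ℤ using (ℤ; +_; -[1+_])
open import Data.Integer.Divisibility as ℤD using ()
open import Data.Fin using (Fin; zero; suc)
open import Data.Product using (Σ; ∃; _×_)
open import Relation.Binary.PropositionalEquality using (_≡_)
open import Data.Nat.Primality using (Prime)
open import Relation.Nullary using (¬_; does)
open import Data.Bool using (if_then_else_)

sumF : ∀ {k} → (Fin k → ℕ) → ℕ
sumF {zero} f = 0
sumF {suc k} f = f zero + sumF (λ i → f (suc i))

gcdAll : ∀ {k} → (Fin k → ℕ) → ℕ
gcdAll {zero} f = 0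
gcdAll {suc k} f = gcd (f zero) (gcdAll (λ i → f (suc i)))

Cong : ℕ → ℕ → ℕ → Set
Cong n x y = (+ n) ℤD.∣ ((+ x) ℤ.- (+ y))

tri : ℕ → ℕ
tri zero = 0
tri (suc x) = suc x + tri x

-- x(x+1)/2 for an integer x: for x = -(m+1) it equals m(m+1)/2
triℤ : ℤ → ℕ
triℤ (+ m) = tri m
triℤ -[1+ m ] = tri m

Tform : ∀ {k} → (Fin k → ℕ) → (Fin k → ℕ) → ℕ
Tform c x = sumF (λ i → c i * tri (x i))

TformZ : ∀ {k} → (Fin k → ℕ) → (Fin k → ℤ) → ℕ
TformZ c x = sumF (λ i → c i * triℤ (x i))

-- q-adic integers ℤ_q as the inverse limit lim ℤ/q^m ℤ: compatible sequences
-- (the m-th component represents the residue mod q^m)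
record Zq (q : ℕ) : Set where
  field
    seq    : ℕ → ℕ
    compat : ∀ m → Cong (q ^ m) (seq (suc m)) (seq m)
open Zq public

Represented : ∀ {k} → (Fin k → ℕ) → ℕ → Set
Represented {k} c n = Σ (Fin k → ℤ) (λ x → TformZ c x ≡ n)

-- Since
-- X_i ≡ seq (X i) (m+1) (mod q^(m+1)), the value T(c)(X) is ≡ T(c)(seq(X)(m+1))
-- modulo q^m (also for q = 2, where the 1/2 costs one power of 2), so the
-- equation in ℤ_q is: for all m, T(c)(X components at level m+1) ≡ n (mod q^m).
SolvesAt : ∀ {k} (q : ℕ) → (Fin k → ℕ) → ℕ → (Fin k → Zq q) → Set
SolvesAt q c n X = ∀ m → Cong (q ^ m) (Tform c (λ i → seq (X i) (suc m))) n

LocallyRepresented : ∀ {k} → (Fin k → ℕ) → ℕ → Set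
LocallyRepresented {k} c n =
  ∀ q → Prime q → Σ (Fin k → Zq q) (λ X → SolvesAt q c n X)

Regular : ∀ {k} → (Fin k → ℕ) → Set
Regular c = ∀ n → 1 ≤ n → LocallyRepresented c n → Represented c n

InDQ : ∀ {k} (p : ℕ) → (Fin k → ℕ) → Zq p → Set
InDQ {k} p c γ = Σ (Fin k → Zq p) (λ y →
  ∀ m → Cong (p ^ m) (sumF (λ i → c i * (seq (y i) m * seq (y i) m))) (seq γ m))

DQNotAll : ∀ {k} (p : ℕ) → (Fin k → ℕ) → Set
DQNotAll p c = Σ (Zq p) (λ γ → ¬ InDQ p c γ)

Λ : ∀ {k} (p : ℕ) → (Fin k → ℕ) → (Fin k → ℕ)
Λ p c i = if does (p ∣? c i) then c i else p ^ 2 * c i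

t : ∀ {k} → ℕ → (Fin k → ℕ) → ℕ
t n c = 8 * n + sumF c

βsum : ∀ {k} (p : ℕ) → (Fin k → ℕ) → ℕ
βsum p c = sumF (λ i → if does (coprime? (c i) p) then c i else 0)

module Submission where

-- Write p = 2h + 1 and B = h(h+1)/2 · β. On the coordinates with p ∤ c_i, the substitution
-- x ↦ p x + h multiplies 2x + 1 by p, and turns T(c) into T(Λ_p(c)) + B. It carries q-adic
-- solutions of T(Λ_p(c)) = n to solutions of T(c) = n + B, and back: for q ≠ p by solving a
-- linear congruence, and for q = p by anisotropy. Indeed, since DQ_p(c) ≠ ℤ_p, Hensel lifting
-- shows that p ∣ Σ c_i z_i² forces p ∣ z_i whenever p ∤ c_i; for z = 2m + 1 the sum is
-- 8n + Σ Λ_p(c)_i (resp. t(n,c)), which is divisible by p, so every representation m of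
-- n + B by T(c) comes from one of n by T(Λ_p(c)). This gives (i), and (ii) is the converse
-- applied to n - B ≥ 0.

open import Defs
open import Data.Nat as ℕ using (ℕ; zero; suc; _+_; _*_; _^_; _≤_; _∸_; NonZero; z≤n; s≤s)
import Data.Nat.Properties as ℕP
open import Data.Nat.Divisibility as ℕD using (_∣_; _∤_; _∣?_; divides)
open import Data.Nat.Coprimality as Coprimality using (Coprime; coprime?; coprime-Bézout; coprime-divisor)
open import Data.Nat.GCD using (module Bézout)
open import Data.Nat.Primality using (Prime; prime⇒irreducible; prime⇒nonZero; euclidsLemma; ¬prime[1]; prime[2])
import Data.Nat.Tactic.RingSolver as ℕSolver
open import Data.Integer using (ℤ; +_; -[1+_])
  renaming (_+_ to _+ᶻ_; _-_ to _-ᶻ_; _*_ to _*ᶻ_; -_ to negate; ∣_∣ to absᶻ)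
import Data.Integer.Properties as ℤP
import Data.Integer.Divisibility.Signed as ℤD
open import Data.Integer.DivMod using (_%ℕ_; _/ℕ_; a≡a%ℕn+[a/ℕn]*n)
import Data.Integer.Tactic.RingSolver as ℤSolver
open import Data.Fin as Fin using (Fin; zero; suc; toℕ)
import Data.Fin.Properties as FinP
open import Data.Vec.Functional using (updateAt)
open import Data.Vec.Functional.Properties using (updateAt-updates; updateAt-minimal)
open import Data.Product using (Σ; ∃; ∃-syntax; _,_; proj₁; proj₂; _×_; map₂)
open import Data.Sum using (_⊎_; inj₁; inj₂)
open import Data.Empty using (⊥)
open import Data.Bool using (if_then_else_)
open import Function using (_∘_)
open import Relation.Nullary using (¬_; yes; no; does; contradiction)
open import Relation.Nullary.Decidable using (dec-true; dec-false; decidable-stable)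
open import Relation.Binary using (Setoid)
import Relation.Binary.Reasoning.Setoid as SetoidReasoning
open import Relation.Binary.PropositionalEquality

prime⇒≢1 : ∀ {p} → Prime p → p ≢ 1
prime⇒≢1 pr refl = ¬prime[1] pr

prime∤⇒coprime : ∀ {p x} → Prime p → p ∤ x → Coprime x p
prime∤⇒coprime pr p∤x (d∣x , d∣p) with prime⇒irreducible pr d∣p
... | inj₁ d≡1 = d≡1
... | inj₂ refl = contradiction d∣x p∤x

prime∣⇒¬coprime : ∀ {p x} → Prime p → p ∣ x → ¬ Coprime x p
prime∣⇒¬coprime pr p∣x coprime = prime⇒≢1 pr (coprime (p∣x , ℕD.∣-refl))

prime∤-* : ∀ {p m n} → Prime p → p ∤ m → p ∤ n → p ∤ m * n
prime∤-* {m = m} {n} pr p∤m p∤n p∣mn with euclidsLemma m n pr p∣mn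
... | inj₁ p∣m = p∤m p∣m
... | inj₂ p∣n = p∤n p∣n

prime∤prime^ : ∀ {r q} → Prime r → Prime q → r ≢ q → ∀ m → r ∤ q ^ m
prime∤prime^ pr pq r≢q zero r∣1 = prime⇒≢1 pr (ℕD.∣1⇒≡1 r∣1)
prime∤prime^ {r} {q} pr pq r≢q (suc m) r∣q^sm with euclidsLemma q (q ^ m) pr r∣q^sm
... | inj₂ r∣q^m = prime∤prime^ pr pq r≢q m r∣q^m
... | inj₁ r∣q with prime⇒irreducible pq r∣q
...   | inj₁ r≡1 = prime⇒≢1 pr r≡1
...   | inj₂ r≡q = r≢q r≡q

odd-prime∤2 : ∀ {p} → Prime p → p ≢ 2 → p ∤ 2
odd-prime∤2 pr p≢2 p∣2 with prime⇒irreducible prime[2] p∣2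
... | inj₁ p≡1 = prime⇒≢1 pr p≡1
... | inj₂ p≡2 = p≢2 p≡2

parity : ∀ n → (∃[ x ] n ≡ 2 * x) ⊎ (∃[ x ] n ≡ 1 + 2 * x)
parity zero = inj₁ (0 , refl)
parity (suc n) with parity n
... | inj₁ (x , refl) = inj₂ (x , refl)
... | inj₂ (x , refl) = inj₁ (suc x , cong suc (sym (ℕP.+-suc x (x + 0))))

odd-prime : ∀ {p} → Prime p → p ≢ 2 → ∃[ h ] p ≡ 1 + 2 * h
odd-prime {p} pr p≢2 with parity p
... | inj₂ odd = odd
... | inj₁ (x , p≡2x) with prime⇒irreducible pr (divides x (trans p≡2x (ℕP.*-comm 2 x)))
...   | inj₁ ()
...   | inj₂ 2≡p = contradiction (sym 2≡p) p≢2

odd-∣-odd : ∀ {p h y} → p ≡ 1 + 2 * h → p ∣ 1 + 2 * y → ∃[ x ] p * x + h ≡ y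
odd-∣-odd {p} {h} {y} p≡ (divides w 1+2y≡wp) with parity w
... | inj₁ (x , refl) = contradiction (trans (sym (ℕP.*-assoc 2 x p)) (sym 1+2y≡wp)) (ℕP.even≢odd (x * p) y)
... | inj₂ (x , refl) = x , ℕP.*-cancelˡ-≡ _ _ 2 (ℕP.suc-injective (sym (begin
    1 + 2 * y                     ≡⟨ 1+2y≡wp ⟩
    (1 + 2 * x) * p               ≡⟨ cong ((1 + 2 * x) *_) p≡ ⟩
    (1 + 2 * x) * (1 + 2 * h)     ≡⟨ expand x h ⟩
    1 + 2 * ((1 + 2 * h) * x + h) ≡⟨ cong (λ e → 1 + 2 * (e * x + h)) p≡ ⟨
    1 + 2 * (p * x + h)           ∎)))
  where
  open ≡-Reasoning
  expand : ∀ x h → (1 + 2 * x) * (1 + 2 * h) ≡ 1 + 2 * ((1 + 2 * h) * x + h)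
  expand = ℕSolver.solve-∀

infix 4 _≡_mod_
record _≡_mod_ (x y M : ℕ) : Set where
  constructor mk≡mod
  field ∣-diff : + M ℤD.∣ + x -ᶻ + y
open _≡_mod_ public

module _ {M : ℕ} where

  private
    rewrite-diff : ∀ {a b} → a ≡ b → + M ℤD.∣ a → + M ℤD.∣ b
    rewrite-diff eq = subst (+ M ℤD.∣_) eq

  mod-reflexive : ∀ {x y} → x ≡ y → x ≡ y mod M
  mod-reflexive {x} refl = mk≡mod (ℤD.divides (+ 0) (trans (ℤP.+-inverseʳ (+ x)) (sym (ℤP.*-zeroˡ (+ M)))))

  mod-refl : ∀ {x} → x ≡ x mod M
  mod-refl = mod-reflexive refl

  mod-sym : ∀ {x y} → x ≡ y mod M → y ≡ x mod M
  mod-sym {x} {y} (mk≡mod d) = mk≡mod (rewrite-diff (negate-diff (+ x) (+ y)) (ℤD.∣m⇒∣-m d))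
    where
    negate-diff : ∀ a b → negate (a -ᶻ b) ≡ b -ᶻ a
    negate-diff = ℤSolver.solve-∀

  mod-trans : ∀ {x y z} → x ≡ y mod M → y ≡ z mod M → x ≡ z mod M
  mod-trans {x} {y} {z} (mk≡mod d) (mk≡mod d′) = mk≡mod (rewrite-diff (telescope (+ x) (+ y) (+ z)) (ℤD.∣m∣n⇒∣m+n d d′))
    where
    telescope : ∀ a b c → (a -ᶻ b) +ᶻ (b -ᶻ c) ≡ a -ᶻ c
    telescope = ℤSolver.solve-∀

  mod-+-cong : ∀ {x y u v} → x ≡ y mod M → u ≡ v mod M → x + u ≡ y + v mod M
  mod-+-cong {x} {y} {u} {v} (mk≡mod d) (mk≡mod d′) = mk≡mod (rewrite-diff eq (ℤD.∣m∣n⇒∣m+n d d′))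
    where
    regroup : ∀ a b c e → (a -ᶻ b) +ᶻ (c -ᶻ e) ≡ (a +ᶻ c) -ᶻ (b +ᶻ e)
    regroup = ℤSolver.solve-∀
    eq : (+ x -ᶻ + y) +ᶻ (+ u -ᶻ + v) ≡ + (x + u) -ᶻ + (y + v)
    eq = trans (regroup (+ x) (+ y) (+ u) (+ v)) (sym (cong₂ _-ᶻ_ (ℤP.pos-+ x u) (ℤP.pos-+ y v)))

  mod-*-cong : ∀ {x y u v} → x ≡ y mod M → u ≡ v mod M → x * u ≡ y * v mod M
  mod-*-cong {x} {y} {u} {v} (mk≡mod d) (mk≡mod d′) = mk≡mod (rewrite-diff eq (ℤD.∣m∣n⇒∣m+n (ℤD.∣n⇒∣m*n (+ x) d′) (ℤD.∣n⇒∣m*n (+ v) d)))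
    where
    regroup : ∀ a b c e → a *ᶻ (c -ᶻ e) +ᶻ e *ᶻ (a -ᶻ b) ≡ a *ᶻ c -ᶻ b *ᶻ e
    regroup = ℤSolver.solve-∀
    eq : + x *ᶻ (+ u -ᶻ + v) +ᶻ + v *ᶻ (+ x -ᶻ + y) ≡ + (x * u) -ᶻ + (y * v)
    eq = trans (regroup (+ x) (+ y) (+ u) (+ v)) (sym (cong₂ _-ᶻ_ (ℤP.pos-* x u) (ℤP.pos-* y v)))

  mod-+-congˡ : ∀ a {x y} → x ≡ y mod M → a + x ≡ a + y mod M
  mod-+-congˡ a = mod-+-cong (mod-refl {a})

  mod-+-congʳ : ∀ a {x y} → x ≡ y mod M → x + a ≡ y + a mod M
  mod-+-congʳ a x≡y = mod-+-cong x≡y mod-refl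

  mod-*-congˡ : ∀ a {x y} → x ≡ y mod M → a * x ≡ a * y mod M
  mod-*-congˡ a = mod-*-cong (mod-refl {a})

  mod-+-cancelʳ : ∀ {x y u} → x + u ≡ y + u mod M → x ≡ y mod M
  mod-+-cancelʳ {x} {y} {u} (mk≡mod d) = mk≡mod (rewrite-diff eq d)
    where
    cancel : ∀ a b c → (a +ᶻ c) -ᶻ (b +ᶻ c) ≡ a -ᶻ b
    cancel = ℤSolver.solve-∀
    eq : + (x + u) -ᶻ + (y + u) ≡ + x -ᶻ + y
    eq = trans (cong₂ _-ᶻ_ (ℤP.pos-+ x u) (ℤP.pos-+ y u)) (cancel (+ x) (+ y) (+ u))

  ∣⇒≡0 : ∀ {x} → M ∣ x → x ≡ 0 mod M
  ∣⇒≡0 {x} d = mk≡mod (rewrite-diff (sym (ℤP.+-identityʳ (+ x))) (ℤD.∣ᵤ⇒∣ d))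

  mod-∣ : ∀ {x y} → x ≡ y mod M → M ∣ y → M ∣ x
  mod-∣ {x} {y} (mk≡mod d) M∣y = ℤD.∣⇒∣ᵤ (rewrite-diff (cancel (+ x) (+ y)) (ℤD.∣m∣n⇒∣m+n d (ℤD.∣ᵤ⇒∣ M∣y)))
    where
    cancel : ∀ a b → (a -ᶻ b) +ᶻ b ≡ a
    cancel = ℤSolver.solve-∀

  fromCong : ∀ {x y} → Cong M x y → x ≡ y mod M
  fromCong c = mk≡mod (ℤD.∣ᵤ⇒∣ c)

  toCong : ∀ {x y} → x ≡ y mod M → Cong M x y
  toCong (mk≡mod d) = ℤD.∣⇒∣ᵤ d

mod-weaken : ∀ {M M′ x y} → M ∣ M′ → x ≡ y mod M′ → x ≡ y mod M
mod-weaken M∣M′ (mk≡mod d) = mk≡mod (ℤD.∣-trans (ℤD.∣ᵤ⇒∣ M∣M′) d)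

mod-setoid : ℕ → Setoid _ _
mod-setoid M = record
  { Carrier = ℕ
  ; _≈_ = λ x y → x ≡ y mod M
  ; isEquivalence = record { refl = mod-refl ; sym = mod-sym ; trans = mod-trans }
  }

module ≡-mod-Reasoning (M : ℕ) = SetoidReasoning (mod-setoid M)

zq : ∀ {q} (s : ℕ → ℕ) → (∀ m → s (suc m) ≡ s m mod q ^ m) → Zq q
zq s s-compat = record { seq = s ; compat = λ m → toCong (s-compat m) }

zq-compat : ∀ {q} (X : Zq q) m → seq X (suc m) ≡ seq X m mod q ^ m
zq-compat X m = fromCong (compat X m)

mod-*-scale : ∀ {M x y} P → x ≡ y mod M → x * P ≡ y * P mod M * P
mod-*-scale {M} {x} {y} P (mk≡mod d) =
  mk≡mod (subst₂ ℤD._∣_ (sym (ℤP.pos-* M P)) eq (ℤD.*-monoˡ-∣ (+ P) d))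
  where
  distrib : ∀ a b c → (a -ᶻ b) *ᶻ c ≡ a *ᶻ c -ᶻ b *ᶻ c
  distrib = ℤSolver.solve-∀
  eq : (+ x -ᶻ + y) *ᶻ + P ≡ + (x * P) -ᶻ + (y * P)
  eq = trans (distrib (+ x) (+ y) (+ P)) (sym (cong₂ _-ᶻ_ (ℤP.pos-* x P) (ℤP.pos-* y P)))

mod-refine : ∀ {P x y} p .{{_ : NonZero p}} → x ≡ y mod P → ∃[ d ] y ≡ x + d * P mod p * P
mod-refine {P} {x} {y} p x≡y = d , mk≡mod (ℤD.divides (D /ℕ p) eq)
  where
  D = ℤD.quotient (∣-diff (mod-sym x≡y))
  d = D %ℕ p
  rescale : ∀ Y X D d q P p → Y -ᶻ X ≡ D *ᶻ P → D ≡ d +ᶻ q *ᶻ p →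
          Y -ᶻ (X +ᶻ d *ᶻ P) ≡ q *ᶻ (p *ᶻ P)
  rescale Y X D d q P p eY eD = begin
    Y -ᶻ (X +ᶻ d *ᶻ P)       ≡⟨ split Y X d P ⟩
    (Y -ᶻ X) -ᶻ d *ᶻ P       ≡⟨ cong (λ e → e -ᶻ d *ᶻ P) eY ⟩
    D *ᶻ P -ᶻ d *ᶻ P         ≡⟨ cong (λ e → e *ᶻ P -ᶻ d *ᶻ P) eD ⟩
    (d +ᶻ q *ᶻ p) *ᶻ P -ᶻ d *ᶻ P ≡⟨ collect d q p P ⟩
    q *ᶻ (p *ᶻ P)             ∎
    where
    open ≡-Reasoning
    split : ∀ Y X d P → Y -ᶻ (X +ᶻ d *ᶻ P) ≡ (Y -ᶻ X) -ᶻ d *ᶻ P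
    split = ℤSolver.solve-∀
    collect : ∀ d q p P → (d +ᶻ q *ᶻ p) *ᶻ P -ᶻ d *ᶻ P ≡ q *ᶻ (p *ᶻ P)
    collect = ℤSolver.solve-∀
  eq : + y -ᶻ + (x + d * P) ≡ D /ℕ p *ᶻ + (p * P)
  eq = subst₂ (λ u v → + y -ᶻ u ≡ D /ℕ p *ᶻ v)
         (sym (trans (ℤP.pos-+ x (d * P)) (cong (λ e → + x +ᶻ e) (ℤP.pos-* d P)))) (sym (ℤP.pos-* p P))
         (rescale (+ y) (+ x) D (+ d) (D /ℕ p) (+ P) (+ p) (ℤD._∣_.equality (∣-diff (mod-sym x≡y))) (a≡a%ℕn+[a/ℕn]*n D p))

∣diff∣-*ˡ : ∀ r x y → absᶻ (+ (r * x) -ᶻ + (r * y)) ≡ r * absᶻ (+ x -ᶻ + y)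
∣diff∣-*ˡ r x y = trans (cong absᶻ (trans (cong₂ _-ᶻ_ (ℤP.pos-* r x) (ℤP.pos-* r y)) (factor (+ r) (+ x) (+ y))))
                        (ℤP.abs-* (+ r) (+ x -ᶻ + y))
  where
  factor : ∀ r a b → r *ᶻ a -ᶻ r *ᶻ b ≡ r *ᶻ (a -ᶻ b)
  factor = ℤSolver.solve-∀

mod-*-cancelˡ : ∀ {M r x y} → Coprime M r → r * x ≡ r * y mod M → x ≡ y mod M
mod-*-cancelˡ {M} {r} {x} {y} coprime rx≡ry =
  fromCong (coprime-divisor coprime (subst (M ∣_) (∣diff∣-*ˡ r x y) (toCong rx≡ry)))

mod-*-cancelˡ-prime^ : ∀ {q r x y} → Prime q → Prime r → ∀ m →
  r * x ≡ r * y mod q ^ suc m → x ≡ y mod q ^ m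
mod-*-cancelˡ-prime^ {q} {r} {x} {y} pq pr m rx≡ry with q ℕ.≟ r
... | yes refl = fromCong (ℕD.*-cancelˡ-∣ q {{prime⇒nonZero pq}}
                   (subst (q ^ suc m ∣_) (∣diff∣-*ˡ r x y) (toCong rx≡ry)))
... | no q≢r = mod-weaken (ℕD.n∣m*n q)
                 (mod-*-cancelˡ (prime∤⇒coprime pr (prime∤prime^ pr pq (q≢r ∘ sym) (suc m))) rx≡ry)

pos-1+* : ∀ m n x y → 1 + m * n ≡ x * y → + 1 +ᶻ + m *ᶻ + n ≡ + x *ᶻ + y
pos-1+* m n x y eq = trans (cong (+ 1 +ᶻ_) (sym (ℤP.pos-* m n))) (trans (cong +_ eq) (ℤP.pos-* x y))

-- Bézout gives an inverse X of u modulo M in ℤ; its multiple X (b - a) is then reduced modulo M.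
solve-linear : ∀ {M} .{{_ : NonZero M}} {u} → Coprime u M → ∀ a b → ∃[ s ] u * s + a ≡ b mod M
solve-linear {M} {u} coprime a b = s , mk≡mod (ℤD.divides (Y *ᶻ (+ b -ᶻ + a) -ᶻ + u *ᶻ (T /ℕ M)) eq)
  where
  open ≡-Reasoning
  inverse : ∃[ X ] ∃[ Y ] + u *ᶻ X -ᶻ + 1 ≡ Y *ᶻ + M
  inverse with coprime-Bézout coprime
  ... | Bézout.+- x y eq = + x , + y , (begin
    + u *ᶻ + x -ᶻ + 1           ≡⟨ swap (+ u) (+ x) ⟩
    + x *ᶻ + u -ᶻ + 1           ≡⟨ cong (_-ᶻ + 1) (pos-1+* y M x u eq) ⟨
    + 1 +ᶻ + y *ᶻ + M -ᶻ + 1    ≡⟨ cancel (+ y *ᶻ + M) ⟩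
    + y *ᶻ + M                  ∎)
    where
    swap : ∀ u x → u *ᶻ x -ᶻ + 1 ≡ x *ᶻ u -ᶻ + 1
    swap = ℤSolver.solve-∀
    cancel : ∀ z → + 1 +ᶻ z -ᶻ + 1 ≡ z
    cancel = ℤSolver.solve-∀
  ... | Bézout.-+ x y eq = negate (+ x) , negate (+ y) , (begin
    + u *ᶻ negate (+ x) -ᶻ + 1  ≡⟨ regroup (+ u) (+ x) ⟩
    negate (+ 1 +ᶻ + x *ᶻ + u)  ≡⟨ cong negate (pos-1+* x u y M eq) ⟩
    negate (+ y *ᶻ + M)         ≡⟨ ℤP.neg-distribˡ-* (+ y) (+ M) ⟩
    negate (+ y) *ᶻ + M         ∎)
    where
    regroup : ∀ u x → u *ᶻ negate x -ᶻ + 1 ≡ negate (+ 1 +ᶻ x *ᶻ u)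
    regroup = ℤSolver.solve-∀
  X = proj₁ inverse
  Y = proj₁ (proj₂ inverse)
  T = X *ᶻ (+ b -ᶻ + a)
  s = T %ℕ M
  residual : ∀ u a b X Y T t q M → u *ᶻ X -ᶻ + 1 ≡ Y *ᶻ M → T ≡ X *ᶻ (b -ᶻ a) → T ≡ t +ᶻ q *ᶻ M →
          (u *ᶻ t +ᶻ a) -ᶻ b ≡ (Y *ᶻ (b -ᶻ a) -ᶻ u *ᶻ q) *ᶻ M
  residual u a b X Y T s q M inv T≡ T≡s+qM = begin
    (u *ᶻ s +ᶻ a) -ᶻ b                    ≡⟨ cong (λ e → (u *ᶻ e +ᶻ a) -ᶻ b) s≡T-qM ⟩
    (u *ᶻ (T -ᶻ q *ᶻ M) +ᶻ a) -ᶻ b        ≡⟨ cong (λ e → (u *ᶻ (e -ᶻ q *ᶻ M) +ᶻ a) -ᶻ b) T≡ ⟩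
    (u *ᶻ (X *ᶻ (b -ᶻ a) -ᶻ q *ᶻ M) +ᶻ a) -ᶻ b ≡⟨ regroup u a b X q M ⟩
    (u *ᶻ X -ᶻ + 1) *ᶻ (b -ᶻ a) -ᶻ u *ᶻ q *ᶻ M ≡⟨ cong (λ e → e *ᶻ (b -ᶻ a) -ᶻ u *ᶻ q *ᶻ M) inv ⟩
    Y *ᶻ M *ᶻ (b -ᶻ a) -ᶻ u *ᶻ q *ᶻ M     ≡⟨ collect Y M b a u q ⟩
    (Y *ᶻ (b -ᶻ a) -ᶻ u *ᶻ q) *ᶻ M        ∎
    where
    s≡T-qM : s ≡ T -ᶻ q *ᶻ M
    s≡T-qM = trans (sym (cancel s (q *ᶻ M))) (cong (_-ᶻ q *ᶻ M) (sym T≡s+qM))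
      where
      cancel : ∀ s z → s +ᶻ z -ᶻ z ≡ s
      cancel = ℤSolver.solve-∀
    regroup : ∀ u a b X q M → (u *ᶻ (X *ᶻ (b -ᶻ a) -ᶻ q *ᶻ M) +ᶻ a) -ᶻ b ≡
                              (u *ᶻ X -ᶻ + 1) *ᶻ (b -ᶻ a) -ᶻ u *ᶻ q *ᶻ M
    regroup = ℤSolver.solve-∀
    collect : ∀ Y M b a u q → Y *ᶻ M *ᶻ (b -ᶻ a) -ᶻ u *ᶻ q *ᶻ M ≡ (Y *ᶻ (b -ᶻ a) -ᶻ u *ᶻ q) *ᶻ M
    collect = ℤSolver.solve-∀
  eq : + (u * s + a) -ᶻ + b ≡ (Y *ᶻ (+ b -ᶻ + a) -ᶻ + u *ᶻ (T /ℕ M)) *ᶻ + M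
  eq = trans (cong (_-ᶻ + b) (trans (ℤP.pos-+ (u * s) a) (cong (_+ᶻ + a) (ℤP.pos-* u s))))
             (residual (+ u) (+ a) (+ b) X Y T (+ s) (T /ℕ M) (+ M)
                    (proj₂ (proj₂ inverse)) refl (a≡a%ℕn+[a/ℕn]*n T M))

tri-double : ∀ x → 2 * tri x ≡ x * suc x
tri-double zero = refl
tri-double (suc x) = begin
  2 * (suc x + tri x)        ≡⟨ ℕP.*-distribˡ-+ 2 (suc x) (tri x) ⟩
  2 * suc x + 2 * tri x      ≡⟨ cong (λ e → 2 * suc x + e) (tri-double x) ⟩
  2 * suc x + x * suc x      ≡⟨ collect x ⟩
  suc x * suc (suc x)        ∎
  where
  open ≡-Reasoning
  collect : ∀ x → 2 * suc x + x * suc x ≡ suc x * suc (suc x)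
  collect = ℕSolver.solve-∀

tri-odd-square : ∀ x → 8 * tri x + 1 ≡ (1 + 2 * x) * (1 + 2 * x)
tri-odd-square x = begin
  8 * tri x + 1              ≡⟨ cong (_+ 1) (ℕP.*-assoc 4 2 (tri x)) ⟩
  4 * (2 * tri x) + 1        ≡⟨ cong (λ e → 4 * e + 1) (tri-double x) ⟩
  4 * (x * suc x) + 1        ≡⟨ complete-square x ⟩
  (1 + 2 * x) * (1 + 2 * x)  ∎
  where
  open ≡-Reasoning
  complete-square : ∀ x → 4 * (x * suc x) + 1 ≡ (1 + 2 * x) * (1 + 2 * x)
  complete-square = ℕSolver.solve-∀

tri-affine : ∀ h x → tri ((1 + 2 * h) * x + h) ≡ (1 + 2 * h) * (1 + 2 * h) * tri x + tri h
tri-affine h x = ℕP.*-cancelˡ-≡ _ _ 2 (begin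
  2 * tri (P * x + h)                       ≡⟨ tri-double (P * x + h) ⟩
  (P * x + h) * suc (P * x + h)             ≡⟨ expand h x ⟩
  P * P * (x * suc x) + h * suc h           ≡⟨ cong₂ (λ u v → P * P * u + v) (tri-double x) (tri-double h) ⟨
  P * P * (2 * tri x) + 2 * tri h           ≡⟨ collect P (tri x) (tri h) ⟩
  2 * (P * P * tri x + tri h)               ∎)
  where
  open ≡-Reasoning
  P = 1 + 2 * h
  expand : ∀ h x → ((1 + 2 * h) * x + h) * suc ((1 + 2 * h) * x + h) ≡
                   (1 + 2 * h) * (1 + 2 * h) * (x * suc x) + h * suc h
  expand = ℕSolver.solve-∀
  collect : ∀ P a b → P * P * (2 * a) + 2 * b ≡ 2 * (P * P * a + b)
  collect = ℕSolver.solve-∀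

tri-mod : ∀ {q x y} → Prime q → ∀ m → x ≡ y mod q ^ suc m → tri x ≡ tri y mod q ^ m
tri-mod {q} {x} {y} pq m x≡y = mod-*-cancelˡ-prime^ pq prime[2] m (begin
  2 * tri x   ≡⟨ tri-double x ⟩
  x * suc x   ≈⟨ mod-*-cong x≡y (mod-+-congˡ 1 x≡y) ⟩
  y * suc y   ≡⟨ tri-double y ⟨
  2 * tri y   ∎)
  where open ≡-mod-Reasoning (q ^ suc m)

sumF-cong : ∀ {k} {f g : Fin k → ℕ} → (∀ i → f i ≡ g i) → sumF f ≡ sumF g
sumF-cong {zero} f≗g = refl
sumF-cong {suc k} f≗g = cong₂ _+_ (f≗g zero) (sumF-cong (f≗g ∘ suc))

sumF-+ : ∀ {k} (f g : Fin k → ℕ) → sumF (λ i → f i + g i) ≡ sumF f + sumF g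
sumF-+ {zero} f g = refl
sumF-+ {suc k} f g = begin
  f zero + g zero + sumF (λ i → f (suc i) + g (suc i))     ≡⟨ cong (λ e → f zero + g zero + e) (sumF-+ (f ∘ suc) (g ∘ suc)) ⟩
  f zero + g zero + (sumF (f ∘ suc) + sumF (g ∘ suc))     ≡⟨ interchange (f zero) (g zero) _ _ ⟩
  f zero + sumF (f ∘ suc) + (g zero + sumF (g ∘ suc))     ∎
  where
  open ≡-Reasoning
  interchange : ∀ a b c d → a + b + (c + d) ≡ a + c + (b + d)
  interchange = ℕSolver.solve-∀

sumF-*ˡ : ∀ {k} a (f : Fin k → ℕ) → sumF (λ i → a * f i) ≡ a * sumF f
sumF-*ˡ {zero} a f = sym (ℕP.*-zeroʳ a)
sumF-*ˡ {suc k} a f = trans (cong (λ e → a * f zero + e) (sumF-*ˡ a (f ∘ suc))) (sym (ℕP.*-distribˡ-+ a (f zero) _))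

sumF-cong-mod : ∀ {k M} {f g : Fin k → ℕ} → (∀ i → f i ≡ g i mod M) → sumF f ≡ sumF g mod M
sumF-cong-mod {zero} f≗g = mod-refl
sumF-cong-mod {suc k} f≗g = mod-+-cong (f≗g zero) (sumF-cong-mod (f≗g ∘ suc))

sumF-∣ : ∀ {k M} {f : Fin k → ℕ} → (∀ i → M ∣ f i) → M ∣ sumF f
sumF-∣ {zero} {M} M∣f = M ℕD.∣0
sumF-∣ {suc k} M∣f = ℕD.∣m∣n⇒∣m+n (M∣f zero) (sumF-∣ (M∣f ∘ suc))

sumF-except : ∀ {k} (j : Fin k) {f g : Fin k → ℕ} → (∀ i → i ≢ j → f i ≡ g i) →
  sumF f + g j ≡ sumF g + f j
sumF-except zero {f} {g} agree = begin
  f zero + sumF (f ∘ suc) + g zero     ≡⟨ cong (λ e → f zero + e + g zero) (sumF-cong (λ i → agree (suc i) λ ())) ⟩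
  f zero + sumF (g ∘ suc) + g zero     ≡⟨ swap (f zero) (sumF (g ∘ suc)) (g zero) ⟩
  g zero + sumF (g ∘ suc) + f zero     ∎
  where
  open ≡-Reasoning
  swap : ∀ a s b → a + s + b ≡ b + s + a
  swap = ℕSolver.solve-∀
sumF-except (suc j) {f} {g} agree = begin
  f zero + sumF (f ∘ suc) + g (suc j)  ≡⟨ ℕP.+-assoc (f zero) _ _ ⟩
  f zero + (sumF (f ∘ suc) + g (suc j)) ≡⟨ cong₂ _+_ (agree zero λ ()) (sumF-except j (λ i i≢j → agree (suc i) (i≢j ∘ FinP.suc-injective))) ⟩
  g zero + (sumF (g ∘ suc) + f (suc j)) ≡⟨ ℕP.+-assoc (g zero) _ _ ⟨
  g zero + sumF (g ∘ suc) + f (suc j)  ∎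
  where open ≡-Reasoning

∣-sumF-except : ∀ {k M} (j : Fin k) {f : Fin k → ℕ} → (∀ i → i ≢ j → M ∣ f i) → M ∣ sumF f → M ∣ f j
∣-sumF-except {M = M} zero {f} M∣others M∣sum =
  ℕD.∣m+n∣m⇒∣n (subst (M ∣_) (ℕP.+-comm (f zero) _) M∣sum) (sumF-∣ (λ i → M∣others (suc i) λ ()))
∣-sumF-except (suc j) M∣others M∣sum =
  ∣-sumF-except j (λ i i≢j → M∣others (suc i) (i≢j ∘ FinP.suc-injective)) (ℕD.∣m+n∣m⇒∣n M∣sum (M∣others zero λ ()))

-- Hensel lifting and anisotropy

Q : ∀ {k} → (Fin k → ℕ) → (Fin k → ℕ) → ℕ
Q c v = sumF (λ i → c i * (v i * v i))

Q-except : ∀ {k} (c : Fin k → ℕ) j {v v′ : Fin k → ℕ} → (∀ i → i ≢ j → v i ≡ v′ i) →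
  Q c v + c j * (v′ j * v′ j) ≡ Q c v′ + c j * (v j * v j)
Q-except c j agree = sumF-except j (λ i i≢j → cong (λ e → c i * (e * e)) (agree i i≢j))

Q-scale : ∀ {k} (c : Fin k → ℕ) a v → Q c (λ i → a * v i) ≡ a * a * Q c v
Q-scale c a v = trans (sumF-cong (λ i → regroup (c i) a (v i))) (sumF-*ˡ (a * a) (λ i → c i * (v i * v i)))
  where
  regroup : ∀ c a x → c * (a * x * (a * x)) ≡ a * a * (c * (x * x))
  regroup = ℕSolver.solve-∀

module _ {k : ℕ} (p : ℕ) (pr : Prime p) (p≢2 : p ≢ 2) (c : Fin k → ℕ) where

  private
    instance
      p≢0 : NonZero p
      p≢0 = prime⇒nonZero pr

  hensel : (γ : Zq p) (w : Fin k → ℕ) (l : Fin k) → p ∤ c l → p ∤ w l → Q c w ≡ seq γ 1 mod p → InDQ p c γ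
  hensel γ w l p∤cl p∤wl Qw≡γ = y , Qy≡γ
    where
    set : ℕ → Fin k → ℕ
    set r = updateAt w l (λ _ → r)

    set-others : ∀ r r′ i → i ≢ l → set r i ≡ set r′ i
    set-others r r′ i i≢l = trans (updateAt-minimal i l w i≢l) (sym (updateAt-minimal i l w i≢l))

    Approx : ℕ → ℕ → Set
    Approx s r = Q c (set r) ≡ seq γ (suc s) mod p ^ suc s × p ∤ r

    lift : ∀ s r → Approx s r → ∃[ r′ ] Approx (suc s) r′ × r′ ≡ r mod p ^ suc s
    lift s r (Qr≡γ , p∤r) = r′ , (Qr′≡γ , p∤r′) , r′≡r
      where
      P = p ^ suc s
      refined = mod-refine p (mod-trans Qr≡γ (mod-sym (zq-compat γ (suc s))))
      d = proj₁ refined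
      u = 2 * c l * r
      p∤u : p ∤ u
      p∤u = prime∤-* pr (prime∤-* pr (odd-prime∤2 pr p≢2) p∤cl) p∤r
      solution = solve-linear (prime∤⇒coprime pr p∤u) 0 d
      a = proj₁ solution
      r′ = r + a * P
      K = c l * a * a * p ^ s
      Q-step : Q c (set r′) ≡ Q c (set r) + u * a * P + p * P * K
      Q-step = ℕP.+-cancelʳ-≡ (c l * (r * r)) _ _ (begin
        Q c (set r′) + c l * (r * r)                  ≡⟨ cong (λ e → Q c (set r′) + c l * (e * e)) (updateAt-updates l w) ⟨
        Q c (set r′) + c l * (set r l * set r l)      ≡⟨ Q-except c l (set-others r′ r) ⟩
        Q c (set r) + c l * (set r′ l * set r′ l)     ≡⟨ cong (λ e → Q c (set r) + c l * (e * e)) (updateAt-updates l w) ⟩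
        Q c (set r) + c l * (r′ * r′)                 ≡⟨ expand (Q c (set r)) (c l) r a p (p ^ s) ⟩
        Q c (set r) + u * a * P + p * P * K + c l * (r * r) ∎)
        where
        open ≡-Reasoning
        expand : ∀ q c r a p ps → q + c * ((r + a * (p * ps)) * (r + a * (p * ps))) ≡
                 q + 2 * c * r * a * (p * ps) + p * (p * ps) * (c * a * a * ps) + c * (r * r)
        expand = ℕSolver.solve-∀
      Qr′≡γ : Q c (set r′) ≡ seq γ (suc (suc s)) mod p * P
      Qr′≡γ = begin
        Q c (set r′)                                  ≡⟨ Q-step ⟩
        Q c (set r) + u * a * P + p * P * K           ≈⟨ mod-+-cong (mod-+-congˡ (Q c (set r)) (mod-*-scale P ua≡d)) (∣⇒≡0 (ℕD.m∣m*n K)) ⟩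
        Q c (set r) + d * P + 0                       ≡⟨ ℕP.+-identityʳ _ ⟩
        Q c (set r) + d * P                           ≈⟨ mod-sym (proj₂ refined) ⟩
        seq γ (suc (suc s))                           ∎
        where
        open ≡-mod-Reasoning (p * P)
        ua≡d : u * a ≡ d mod p
        ua≡d = mod-trans (mod-reflexive (sym (ℕP.+-identityʳ (u * a)))) (proj₂ solution)
      p∤r′ : p ∤ r′
      p∤r′ p∣r′ = p∤r (ℕD.∣m+n∣m⇒∣n (subst (p ∣_) (ℕP.+-comm r (a * P)) p∣r′) (ℕD.∣n⇒∣m*n a (ℕD.m∣m*n (p ^ s))))
      r′≡r : r′ ≡ r mod P
      r′≡r = mod-trans (mod-+-congˡ r (∣⇒≡0 (ℕD.n∣m*n a))) (mod-reflexive (ℕP.+-identityʳ r))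

    approx : ∀ s → ∃ (Approx s)
    approx zero = w l , Qw≡γ′ , p∤wl
      where
      set-self : ∀ i → set (w l) i ≡ w i
      set-self i with i Fin.≟ l
      ... | yes refl = updateAt-updates l w
      ... | no i≢l = updateAt-minimal i l w i≢l
      Qw≡γ′ : Q c (set (w l)) ≡ seq γ 1 mod p ^ 1
      Qw≡γ′ = mod-weaken (ℕD.∣-reflexive (ℕP.*-identityʳ p))
        (subst (_≡ seq γ 1 mod p) (sumF-cong (λ i → cong (λ e → c i * (e * e)) (sym (set-self i)))) Qw≡γ)
    approx (suc s) = map₂ proj₁ (lift s _ (proj₂ (approx s)))

    R : ℕ → ℕ
    R zero = w l
    R (suc s) = proj₁ (approx s)

    R-compat : ∀ m → R (suc m) ≡ R m mod p ^ m
    R-compat zero = fromCong (ℕD.1∣ _)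
    R-compat (suc s) = proj₂ (proj₂ (lift s _ (proj₂ (approx s))))

    y : Fin k → Zq p
    y i = zq (λ m → set (R m) i) y-compat
      where
      y-compat : ∀ m → set (R (suc m)) i ≡ set (R m) i mod p ^ m
      y-compat m with i Fin.≟ l
      ... | yes refl = subst₂ (λ a b → a ≡ b mod p ^ m) (sym (updateAt-updates l w)) (sym (updateAt-updates l w)) (R-compat m)
      ... | no i≢l = mod-reflexive (set-others _ _ i i≢l)

    Qy≡γ : ∀ m → Cong (p ^ m) (Q c (λ i → set (R m) i)) (seq γ m)
    Qy≡γ zero = ℕD.1∣ _
    Qy≡γ (suc s) = toCong (proj₁ (proj₂ (approx s)))

  -- If p ∤ z j, some w = μ z + e_j has Q c w ≡ seq γ 1 (mod p) and a coordinate to which Hensel lifting applies.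
  anisotropic : DQNotAll p c → ∀ z → p ∣ Q c z → ∀ j → p ∤ c j → p ∣ z j
  anisotropic (γ , γ∉DQ) z p∣Qz j p∤cj = decidable-stable (p ∣? z j) z-unit-absurd
    where
    hensel-absurd : ∀ w → Q c w ≡ seq γ 1 mod p → ∀ i → p ∤ c i → p ∤ w i → ⊥
    hensel-absurd w Qw≡γ i p∤ci p∤wi = γ∉DQ (hensel γ w i p∤ci p∤wi Qw≡γ)

    z-unit-absurd : p ∤ z j → ⊥
    z-unit-absurd p∤zj = prime∤-* pr p∤cj (prime∤-* pr p∤zj p∤zj) (∣-sumF-except j p∣others p∣Qz)
      where
      u = 2 * (c j * z j)
      p∤u : p ∤ u
      p∤u = prime∤-* pr (odd-prime∤2 pr p≢2) (prime∤-* pr p∤cj p∤zj)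
      solution = solve-linear (prime∤⇒coprime pr p∤u) (c j) (seq γ 1)
      μ = proj₁ solution
      w : Fin k → ℕ
      w = updateAt (λ i → μ * z i) j suc

      Q-w : Q c w ≡ μ * μ * Q c z + (u * μ + c j)
      Q-w = ℕP.+-cancelʳ-≡ (c j * (μ * z j * (μ * z j))) _ _ (begin
        Q c w + c j * (μ * z j * (μ * z j))         ≡⟨ Q-except c j (λ i i≢j → updateAt-minimal i j _ i≢j) ⟩
        Q c (λ i → μ * z i) + c j * (w j * w j)     ≡⟨ cong₂ (λ a b → a + c j * (b * b)) (Q-scale c μ z) (updateAt-updates j _) ⟩
        μ * μ * Q c z + c j * (suc (μ * z j) * suc (μ * z j)) ≡⟨ expand (μ * μ * Q c z) (c j) μ (z j) ⟩
        μ * μ * Q c z + (u * μ + c j) + c j * (μ * z j * (μ * z j)) ∎)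
        where
        open ≡-Reasoning
        expand : ∀ q c m z → q + c * (suc (m * z) * suc (m * z)) ≡ q + (2 * (c * z) * m + c) + c * (m * z * (m * z))
        expand = ℕSolver.solve-∀

      Qw≡γ : Q c w ≡ seq γ 1 mod p
      Qw≡γ = begin
        Q c w                          ≡⟨ Q-w ⟩
        μ * μ * Q c z + (u * μ + c j)  ≈⟨ mod-+-cong (∣⇒≡0 (ℕD.∣n⇒∣m*n (μ * μ) p∣Qz)) (proj₂ solution) ⟩
        seq γ 1                        ∎
        where open ≡-mod-Reasoning p

      p∣wj : p ∣ w j
      p∣wj = decidable-stable (p ∣? w j) (hensel-absurd w Qw≡γ j p∤cj)

      p∤μ : p ∤ μ
      p∤μ p∣μ = prime⇒≢1 pr (ℕD.∣1⇒≡1 (ℕD.∣m+n∣m⇒∣n (subst (p ∣_) (trans (updateAt-updates j _) (ℕP.+-comm 1 _)) p∣wj) (ℕD.∣m⇒∣m*n (z j) p∣μ)))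

      p∣others : ∀ i → i ≢ j → p ∣ c i * (z i * z i)
      p∣others i i≢j = decidable-stable (p ∣? _) λ p∤term →
        hensel-absurd w Qw≡γ i (λ p∣ci → p∤term (ℕD.∣m⇒∣m*n _ p∣ci))
          (λ p∣wi → prime∤-* pr p∤μ (λ p∣zi → p∤term (ℕD.∣n⇒∣m*n (c i) (ℕD.∣m⇒∣m*n (z i) p∣zi)))
                      (subst (p ∣_) (updateAt-minimal i j _ i≢j) p∣wi))

Q-odd : ∀ {k} (d x : Fin k → ℕ) → Q d (λ i → 1 + 2 * x i) ≡ 8 * Tform d x + sumF d
Q-odd d x = begin
  Q d (λ i → 1 + 2 * x i)                        ≡⟨ sumF-cong (λ i → cong (d i *_) (tri-odd-square (x i))) ⟨
  sumF (λ i → d i * (8 * tri (x i) + 1))          ≡⟨ sumF-cong (λ i → distrib (d i) (tri (x i))) ⟩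
  sumF (λ i → 8 * (d i * tri (x i)) + d i)        ≡⟨ sumF-+ (λ i → 8 * (d i * tri (x i))) d ⟩
  sumF (λ i → 8 * (d i * tri (x i))) + sumF d     ≡⟨ cong (_+ sumF d) (sumF-*ˡ 8 (λ i → d i * tri (x i))) ⟩
  8 * Tform d x + sumF d                          ∎
  where
  open ≡-Reasoning
  distrib : ∀ d t → d * (8 * t + 1) ≡ 8 * (d * t) + d
  distrib = ℕSolver.solve-∀

solves-mod : ∀ {k q} (d : Fin k → ℕ) n (X : Fin k → Zq q) → SolvesAt q d n X → ∀ m →
  Tform d (λ i → seq (X i) (suc m)) ≡ n mod q ^ m
solves-mod d n X sol m = fromCong (sol m)

solves-intro : ∀ {k q} (d : Fin k → ℕ) n (X : Fin k → Zq q) →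
  (∀ m → Tform d (λ i → seq (X i) (suc m)) ≡ n mod q ^ m) → SolvesAt q d n X
solves-intro d n X sol m = toCong (sol m)

solves⇒odd-square-mod : ∀ {k q} (d : Fin k → ℕ) n (X : Fin k → Zq q) → SolvesAt q d n X → ∀ m →
  Q d (λ i → 1 + 2 * seq (X i) (suc (suc m))) ≡ t n d mod q
solves⇒odd-square-mod {q = q} d n X sol m = begin
  Q d (λ i → 1 + 2 * seq (X i) (suc (suc m)))         ≡⟨ Q-odd d (λ i → seq (X i) (suc (suc m))) ⟩
  8 * Tform d (λ i → seq (X i) (suc (suc m))) + sumF d ≈⟨ mod-+-congʳ (sumF d) (mod-*-congˡ 8 (mod-weaken (ℕD.m∣m*n (q ^ m)) (solves-mod d n X sol (suc m)))) ⟩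
  t n d                                                ∎
  where open ≡-mod-Reasoning q

Tform-zero : ∀ {k} (d : Fin k → ℕ) → Tform d (λ _ → 0) ≡ 0
Tform-zero {zero} d = refl
Tform-zero {suc k} d = cong₂ _+_ (ℕP.*-zeroʳ (d zero)) (Tform-zero (d ∘ suc))

Represented⇒ℕ : ∀ {k} {d : Fin k → ℕ} {n} → Represented d n → ∃[ x ] Tform d x ≡ n
Represented⇒ℕ {d = d} (y , dy≡n) = (λ i → fold (y i)) , trans (sumF-cong (λ i → cong (d i *_) (tri-fold (y i)))) dy≡n
  where
  -- x(x+1)/2 is invariant under x ↦ -1 - x, which maps ℤ onto ℕ.
  fold : ℤ → ℕ
  fold (+ m) = m
  fold -[1+ m ] = m
  tri-fold : ∀ y → tri (fold y) ≡ triℤ y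
  tri-fold (+ m) = refl
  tri-fold -[1+ m ] = refl

regular⇒ℕ : ∀ {k} (d : Fin k → ℕ) → Regular d → ∀ n → LocallyRepresented d n → ∃[ x ] Tform d x ≡ n
regular⇒ℕ d regular zero _ = (λ _ → 0) , Tform-zero d
regular⇒ℕ d regular (suc n) local = Represented⇒ℕ {d = d} (regular (suc n) (s≤s z≤n) local)

-- The substitution relating T(c) and T(Λ_p(c))

module _ {k : ℕ} (p : ℕ) (pr : Prime p) (p≢2 : p ≢ 2) (c : Fin k → ℕ) where

  private
    instance
      p≢0 : NonZero p
      p≢0 = prime⇒nonZero pr

    h : ℕ
    h = proj₁ (odd-prime pr p≢2)

    p≡1+2h : p ≡ 1 + 2 * h
    p≡1+2h = proj₂ (odd-prime pr p≢2)

  p²≡1+8tri : p ^ 2 ≡ 1 + 8 * tri h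
  p²≡1+8tri = begin
    p * (p * 1)               ≡⟨ cong (p *_) (ℕP.*-identityʳ p) ⟩
    p * p                     ≡⟨ cong₂ _*_ p≡1+2h p≡1+2h ⟩
    (1 + 2 * h) * (1 + 2 * h) ≡⟨ tri-odd-square h ⟨
    8 * tri h + 1             ≡⟨ ℕP.+-comm _ 1 ⟩
    1 + 8 * tri h             ∎
    where open ≡-Reasoning

  -- For p ∤ c i, φ i sends x to the y with 2y + 1 = p (2x + 1).
  φ : Fin k → ℕ → ℕ
  φ i x = if does (p ∣? c i) then x else p * x + h

  β-term : Fin k → ℕ
  β-term i = if does (coprime? (c i) p) then c i else 0

  shift : ℕ
  shift = tri h * βsum p c

  module _ {i : Fin k} where

    β-term-∣ : p ∣ c i → β-term i ≡ 0
    β-term-∣ p∣ci = cong (λ b → if b then c i else 0) (dec-false (coprime? (c i) p) (prime∣⇒¬coprime pr p∣ci))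

    β-term-∤ : p ∤ c i → β-term i ≡ c i
    β-term-∤ p∤ci = cong (λ b → if b then c i else 0) (dec-true (coprime? (c i) p) (prime∤⇒coprime pr p∤ci))

  c-tri-φ : ∀ i x → c i * tri (φ i x) ≡ Λ p c i * tri x + tri h * β-term i
  c-tri-φ i x with p ∣? c i
  ... | yes p∣ci = begin
    c i * tri x                        ≡⟨ ℕP.+-identityʳ _ ⟨
    c i * tri x + 0                    ≡⟨ cong (λ e → c i * tri x + e) (ℕP.*-zeroʳ (tri h)) ⟨
    c i * tri x + tri h * 0            ≡⟨ cong (λ b → c i * tri x + tri h * b) (β-term-∣ p∣ci) ⟨
    c i * tri x + tri h * β-term i     ∎
    where open ≡-Reasoning
  ... | no p∤ci = begin
    c i * tri (p * x + h)                          ≡⟨ cong (λ e → c i * tri (e * x + h)) p≡1+2h ⟩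
    c i * tri ((1 + 2 * h) * x + h)                ≡⟨ cong (c i *_) (tri-affine h x) ⟩
    c i * ((1 + 2 * h) * (1 + 2 * h) * tri x + tri h) ≡⟨ distrib (c i) (1 + 2 * h) (tri x) (tri h) ⟩
    (1 + 2 * h) * ((1 + 2 * h) * 1) * c i * tri x + tri h * c i ≡⟨ cong (λ e → e * (e * 1) * c i * tri x + tri h * c i) p≡1+2h ⟨
    p ^ 2 * c i * tri x + tri h * c i              ≡⟨ cong (λ b → p ^ 2 * c i * tri x + tri h * b) (β-term-∤ p∤ci) ⟨
    p ^ 2 * c i * tri x + tri h * β-term i         ∎
    where
    open ≡-Reasoning
    distrib : ∀ c P a b → c * (P * P * a + b) ≡ P * (P * 1) * c * a + b * c
    distrib = ℕSolver.solve-∀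

  Λ≡+8tri : ∀ i → Λ p c i ≡ c i + 8 * tri h * β-term i
  Λ≡+8tri i with p ∣? c i
  ... | yes p∣ci = begin
    c i                            ≡⟨ ℕP.+-identityʳ _ ⟨
    c i + 0                        ≡⟨ cong (λ e → c i + e) (ℕP.*-zeroʳ (8 * tri h)) ⟨
    c i + 8 * tri h * 0            ≡⟨ cong (λ e → c i + 8 * tri h * e) (β-term-∣ p∣ci) ⟨
    c i + 8 * tri h * β-term i     ∎
    where open ≡-Reasoning
  ... | no p∤ci = begin
    p ^ 2 * c i                    ≡⟨ cong (_* c i) p²≡1+8tri ⟩
    (1 + 8 * tri h) * c i          ≡⟨ distrib (tri h) (c i) ⟩
    c i + 8 * tri h * c i          ≡⟨ cong (λ e → c i + 8 * tri h * e) (β-term-∤ p∤ci) ⟨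
    c i + 8 * tri h * β-term i     ∎
    where
    open ≡-Reasoning
    distrib : ∀ t c → (1 + 8 * t) * c ≡ c + 8 * t * c
    distrib = ℕSolver.solve-∀

  p∣Λ : ∀ i → p ∣ Λ p c i
  p∣Λ i with p ∣? c i
  ... | yes p∣ci = p∣ci
  ... | no p∤ci = ℕD.∣m⇒∣m*n (c i) (ℕD.m∣m*n (p * 1))

  Tform-φ : ∀ x → Tform c (λ i → φ i (x i)) ≡ Tform (Λ p c) x + shift
  Tform-φ x = begin
    Tform c (λ i → φ i (x i))                                     ≡⟨ sumF-cong (λ i → c-tri-φ i (x i)) ⟩
    sumF (λ i → Λ p c i * tri (x i) + tri h * β-term i)           ≡⟨ sumF-+ (λ i → Λ p c i * tri (x i)) (λ i → tri h * β-term i) ⟩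
    Tform (Λ p c) x + sumF (λ i → tri h * β-term i)               ≡⟨ cong (λ e → Tform (Λ p c) x + e) (sumF-*ˡ (tri h) β-term) ⟩
    Tform (Λ p c) x + shift                                       ∎
    where open ≡-Reasoning

  t-Λ : ∀ n → t n (Λ p c) ≡ t (n + shift) c
  t-Λ n = begin
    8 * n + sumF (Λ p c)                                 ≡⟨ cong (λ e → 8 * n + e) (sumF-cong Λ≡+8tri) ⟩
    8 * n + sumF (λ i → c i + 8 * tri h * β-term i)      ≡⟨ cong (λ e → 8 * n + e) (sumF-+ c _) ⟩
    8 * n + (sumF c + sumF (λ i → 8 * tri h * β-term i)) ≡⟨ cong (λ e → 8 * n + (sumF c + e)) (sumF-*ˡ (8 * tri h) β-term) ⟩
    8 * n + (sumF c + 8 * tri h * βsum p c)              ≡⟨ regroup n (sumF c) (tri h) (βsum p c) ⟩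
    8 * (n + shift) + sumF c                             ∎
    where
    open ≡-Reasoning
    regroup : ∀ n s a b → 8 * n + (s + 8 * a * b) ≡ 8 * (n + a * b) + s
    regroup = ℕSolver.solve-∀

  φ-inverse : ∀ i y → (p ∤ c i → p ∣ 1 + 2 * y) → ∃[ x ] φ i x ≡ y
  φ-inverse i y p∣odd with p ∣? c i
  ... | yes _ = y , refl
  ... | no p∤ci = odd-∣-odd p≡1+2h (p∣odd p∤ci)

  φ-mod : ∀ {M} i {x y} → x ≡ y mod M → φ i x ≡ φ i y mod M
  φ-mod i x≡y with p ∣? c i
  ... | yes _ = x≡y
  ... | no _ = mod-+-congʳ h (mod-*-congˡ p x≡y)

  φ-cancel : ∀ {q} → Prime q → ∀ i m {x y} → φ i x ≡ φ i y mod q ^ suc m → x ≡ y mod q ^ m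
  φ-cancel {q} pq i m φx≡φy with p ∣? c i
  ... | yes _ = mod-weaken (ℕD.n∣m*n q) φx≡φy
  ... | no _ = mod-*-cancelˡ-prime^ pq pr m (mod-+-cancelʳ φx≡φy)

  φ-solve : ∀ {M} .{{_ : NonZero M}} → Coprime p M → ∀ i y → ∃[ x ] φ i x ≡ y mod M
  φ-solve coprime i y with p ∣? c i
  ... | yes _ = y , mod-refl
  ... | no _ = solve-linear coprime h y

  Λ-local⇒c-local : ∀ {n} → LocallyRepresented (Λ p c) n → LocallyRepresented c (n + shift)
  Λ-local⇒c-local {n} local q pq = Y , Y-solves
    where
    X = proj₁ (local q pq)
    Y : Fin k → Zq q
    Y i = zq (λ m → φ i (seq (X i) m)) (λ m → φ-mod i (zq-compat (X i) m))
    Y-solves : SolvesAt q c (n + shift) Y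
    Y-solves = solves-intro c (n + shift) Y Y-level
      where
      Y-level : ∀ m → Tform c (λ i → φ i (seq (X i) (suc m))) ≡ n + shift mod q ^ m
      Y-level m = begin
        Tform c (λ i → φ i (seq (X i) (suc m)))         ≡⟨ Tform-φ (λ i → seq (X i) (suc m)) ⟩
        Tform (Λ p c) (λ i → seq (X i) (suc m)) + shift ≈⟨ mod-+-congʳ shift (solves-mod (Λ p c) n X (proj₂ (local q pq)) m) ⟩
        n + shift                                       ∎
        where open ≡-mod-Reasoning (q ^ m)

  Λ-solution : ∀ {q N} → Prime q → (Y : Fin k → Zq q) → SolvesAt q c (N + shift) Y →
    (∀ i m → ∃[ x ] φ i x ≡ seq (Y i) (suc m) mod q ^ suc m) → Σ (Fin k → Zq q) (SolvesAt q (Λ p c) N)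
  Λ-solution {q} {N} pq Y Y-solves preimage = X , X-solves
    where
    x : Fin k → ℕ → ℕ
    x i m = proj₁ (preimage i m)
    φx≡Y : ∀ i m → φ i (x i m) ≡ seq (Y i) (suc m) mod q ^ suc m
    φx≡Y i m = proj₂ (preimage i m)
    x-compat : ∀ i m → x i (suc m) ≡ x i m mod q ^ m
    x-compat i m = φ-cancel pq i m (begin
      φ i (x i (suc m))         ≈⟨ mod-weaken (ℕD.n∣m*n q) (φx≡Y i (suc m)) ⟩
      seq (Y i) (suc (suc m))   ≈⟨ zq-compat (Y i) (suc m) ⟩
      seq (Y i) (suc m)         ≈⟨ mod-sym (φx≡Y i m) ⟩
      φ i (x i m)               ∎)
      where open ≡-mod-Reasoning (q ^ suc m)
    X : Fin k → Zq q
    X i = zq (x i) (x-compat i)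
    X-solves : SolvesAt q (Λ p c) N X
    X-solves = solves-intro (Λ p c) N X λ m → mod-+-cancelʳ (mod-weaken (ℕD.n∣m*n q) (shifted m))
      where
      shifted : ∀ m → Tform (Λ p c) (λ i → x i (suc m)) + shift ≡ N + shift mod q ^ suc m
      shifted m = begin
        Tform (Λ p c) (λ i → x i (suc m)) + shift   ≡⟨ Tform-φ (λ i → x i (suc m)) ⟨
        Tform c (λ i → φ i (x i (suc m)))           ≈⟨ sumF-cong-mod (λ i → mod-*-congˡ (c i) (tri-mod pq (suc m) (φx≡Y i (suc m)))) ⟩
        Tform c (λ i → seq (Y i) (suc (suc m)))     ≈⟨ solves-mod c (N + shift) Y Y-solves (suc m) ⟩
        N + shift                                   ∎
        where open ≡-mod-Reasoning (q ^ suc m)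

  c-local⇒Λ-local : DQNotAll p c → ∀ {N} → p ∣ t (N + shift) c →
    LocallyRepresented c (N + shift) → LocallyRepresented (Λ p c) N
  c-local⇒Λ-local dq {N} p∣t local q pq = Λ-solution {N = N} pq Y Y-solves preimage
    where
    Y = proj₁ (local q pq)
    Y-solves = proj₂ (local q pq)
    preimage : ∀ i m → ∃[ x ] φ i x ≡ seq (Y i) (suc m) mod q ^ suc m
    preimage with q ℕ.≟ p
    ... | yes refl = λ i m →
      let p∣odd = λ p∤ci → anisotropic p pr p≢2 c dq (λ i → 1 + 2 * seq (Y i) (suc (suc m)))
                    (mod-∣ (solves⇒odd-square-mod c (N + shift) Y Y-solves m) p∣t) i p∤ci
          (x , φx≡Y) = φ-inverse i (seq (Y i) (suc (suc m))) p∣odd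
      in x , mod-trans (mod-reflexive φx≡Y) (zq-compat (Y i) (suc m))
    ... | no q≢p = λ i m → φ-solve {{ℕP.m^n≢0 q (suc m) {{prime⇒nonZero pq}}}}
                             (Coprimality.sym (prime∤⇒coprime pr (prime∤prime^ pr pq (q≢p ∘ sym) (suc m)))) i (seq (Y i) (suc m))

  local⇒p∣t-Λ : ∀ {n} → LocallyRepresented (Λ p c) n → p ∣ t n (Λ p c)
  local⇒p∣t-Λ {n} local =
    mod-∣ (mod-sym (solves⇒odd-square-mod (Λ p c) n (proj₁ (local p pr)) (proj₂ (local p pr)) 0))
          (sumF-∣ (λ i → ℕD.∣m⇒∣m*n _ (p∣Λ i)))

  regular⇒Λ-represents : DQNotAll p c → Regular c → ∀ n → LocallyRepresented (Λ p c) n → Represented (Λ p c) n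
  regular⇒Λ-represents dq regular n local = (λ i → + x i) , Tform-x
    where
    representation = regular⇒ℕ c regular (n + shift) (Λ-local⇒c-local {n} local)
    m = proj₁ representation
    Tform-m : Tform c m ≡ n + shift
    Tform-m = proj₂ representation
    p∣Q-odd : p ∣ Q c (λ i → 1 + 2 * m i)
    p∣Q-odd = subst (p ∣_) (sym (begin
      Q c (λ i → 1 + 2 * m i)   ≡⟨ Q-odd c m ⟩
      8 * Tform c m + sumF c    ≡⟨ cong (λ e → 8 * e + sumF c) Tform-m ⟩
      t (n + shift) c           ≡⟨ t-Λ n ⟨
      t n (Λ p c)               ∎)) (local⇒p∣t-Λ {n} local)
      where open ≡-Reasoning
    preimage : ∀ i → ∃[ x ] φ i x ≡ m i
    preimage i = φ-inverse i (m i) (anisotropic p pr p≢2 c dq (λ i → 1 + 2 * m i) p∣Q-odd i)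
    x : Fin k → ℕ
    x i = proj₁ (preimage i)
    Tform-x : Tform (Λ p c) x ≡ n
    Tform-x = ℕP.+-cancelʳ-≡ shift _ _ (begin
      Tform (Λ p c) x + shift       ≡⟨ Tform-φ x ⟨
      Tform c (λ i → φ i (x i))     ≡⟨ sumF-cong (λ i → cong (λ e → c i * tri e) (proj₂ (preimage i))) ⟩
      Tform c m                     ≡⟨ Tform-m ⟩
      n + shift                     ∎)
      where open ≡-Reasoning

  Λ-regular⇒represents : DQNotAll p c → Regular (Λ p c) → ∀ n → LocallyRepresented c n → p ∣ t n c →
    (p ^ 2 ∸ 1) * βsum p c ≤ 8 * n → Represented c n
  Λ-regular⇒represents dq regular n local p∣t bound = (λ i → + φ i (x i)) , Tform-φx
    where
    shift≤n : shift ≤ n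
    shift≤n = ℕP.*-cancelˡ-≤ 8 (subst (_≤ 8 * n)
      (trans (cong (λ e → (e ∸ 1) * βsum p c) p²≡1+8tri) (ℕP.*-assoc 8 (tri h) (βsum p c))) bound)
    N = n ∸ shift
    N+shift≡n : N + shift ≡ n
    N+shift≡n = ℕP.m∸n+n≡m shift≤n
    Λ-local : LocallyRepresented (Λ p c) N
    Λ-local = c-local⇒Λ-local dq {N} (subst (λ e → p ∣ t e c) (sym N+shift≡n) p∣t)
                                 (subst (LocallyRepresented c) (sym N+shift≡n) local)
    representation = regular⇒ℕ (Λ p c) regular N Λ-local
    x = proj₁ representation
    Tform-φx : Tform c (λ i → φ i (x i)) ≡ n
    Tform-φx = trans (Tform-φ x) (trans (cong (_+ shift) (proj₂ representation)) N+shift≡n)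

lemma3p5 : (k : ℕ) → 4 ≤ k → (p : ℕ) → Prime p → p ≢ 2 →
    (a e : Fin k → ℕ) →
    (∀ i → toℕ i ≡ 0 → e i ≡ 0) →
    (∀ i j → 1 ≤ toℕ i → toℕ i ≤ toℕ j → e i ≤ e j) →
    (∀ i → 1 ≤ a i) →
    (∀ i → Coprime (a i) p) →
    gcdAll (λ i → p ^ e i * a i) ≡ 1 →
    DQNotAll p (λ i → p ^ e i * a i) →
    (n : ℕ) →
      (Regular (λ i → p ^ e i * a i) →
        LocallyRepresented (Λ p (λ i → p ^ e i * a i)) n →
        Represented (Λ p (λ i → p ^ e i * a i)) n)
    × (Regular (Λ p (λ i → p ^ e i * a i)) →
        LocallyRepresented (λ i → p ^ e i * a i) n →
        p ∣ t n (λ i → p ^ e i * a i) →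
        (p ^ 2 ∸ 1) * βsum p (λ i → p ^ e i * a i) ≤ 8 * n →
        Represented (λ i → p ^ e i * a i) n)
lemma3p5 k _ p pr p≢2 a e _ _ _ _ _ dq n =
  (λ regular → regular⇒Λ-represents p pr p≢2 c dq regular n) ,
  (λ regular → Λ-regular⇒represents p pr p≢2 c dq regular n)
  where
  c : Fin k → ℕ
  c i = p ^ e i * a i
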